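{- Let $q$ be a power of an odd prime and let $G$ be a connected labeled graph over $\mathbf{F}_q$ on $\{1,\dots,n\}$. Then for every $(X,Y,Z,T)\in\Lambda(G,G)$ there is $a\in\mathbf{F}_q$ with $Y+Z=aI$, i.e. $Y(i)+Z(i)$ is the same for all vertices $i$.
   Context: A labeled graph is a symmetric matrix $G=(g_{ij})$ over $\mathbf{F}_q$ with zero diagonal; $ij$ is an edge iff $g_{ij}\ne0$, and $G$ is connected if the resulting simple graph is connected. Its neighborhood function is $g(i)=(g_{i1},\dots,g_{in})$. $I$ denotes the all-ones vector of $\mathbf{F}_q^n$, $e_i$ the standard basis vectors, $\times$ the coordinatewise product, $\langle u,v\rangle=\sum_k u_kv_k$. $\Lambda(G,G)$ is the set of $(X,Y,Z,T)\in(\mathbf{F}_q^n)^4$ such that for all vertices $i,j$: $\langle X,g(i)\times g(j)\rangle-\langle Y,g(i)\times e_j\rangle+\langle Z,e_i\times g(j)\rangle-\langle T,e_i\times e_j\rangle=0$. -}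

module Defs where

open import Level using (0ℓ)
open import Data.Nat using (ℕ; zero; suc)
open import Data.Fin using (Fin; zero; suc; _≟_)
open import Data.Product using (∃)
open import Relation.Nullary using (¬_; yes; no)
open import Relation.Binary.PropositionalEquality using (_≡_; _≢_)
open import Relation.Binary.Construct.Closure.ReflexiveTransitive using (Star)
open import Algebra.Core using (Op₁; Op₂)
open import Algebra.Structures using (IsCommutativeRing)
open import Function.Bundles using (_⤖_)

record FiniteField : Set₁ where
  infixl 7 _*_
  infixl 6 _+_ _-_
  field
    Carrier : Set
    _+_ _*_ : Op₂ Carrier
    -_      : Op₁ Carrier
    0# 1#   : Carrier
    isCommutativeRing : IsCommutativeRing _≡_ _+_ _*_ -_ 0# 1#
    0≢1     : 0# ≢ 1#
    inverse : ∀ x → x ≢ 0# → ∃ λ y → x * y ≡ 1#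
    size    : ℕ
    enumeration : Carrier ⤖ Fin size

  _-_ : Op₂ Carrier
  x - y = x + (- y)

module _ (F : FiniteField) where
  open FiniteField F

  -- vectors of F_q^n as functions on the vertex set {1..n} = Fin n
  Vector : ℕ → Set
  Vector n = Fin n → Carrier

  Σ : ∀ {n} → Vector n → Carrier
  Σ {zero}  v = 0#
  Σ {suc n} v = v zero + Σ (λ k → v (suc k))

  ⟨_,_⟩ : ∀ {n} → Vector n → Vector n → Carrier
  ⟨ u , v ⟩ = Σ (λ k → u k * v k)

  _×ᵥ_ : ∀ {n} → Vector n → Vector n → Vector n
  (u ×ᵥ v) k = u k * v k

  𝟙 : ∀ {n} → Vector n
  𝟙 k = 1#

  e : ∀ {n} → Fin n → Vector n
  e i k with i ≟ k
  ... | yes _ = 1#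
  ... | no  _ = 0#

  record LabeledGraph (n : ℕ) : Set where
    field
      g        : Fin n → Fin n → Carrier
      symmetric : ∀ i j → g i j ≡ g j i
      zeroDiag : ∀ i → g i i ≡ 0#

  module _ {n : ℕ} (G : LabeledGraph n) where
    open LabeledGraph G

    Edge : Fin n → Fin n → Set
    Edge i j = g i j ≢ 0#

    Connected : Set
    Connected = ∀ i j → Star Edge i j

    InΛ : Vector n → Vector n → Vector n → Vector n → Set
    InΛ X Y Z T = ∀ i j →
      ((⟨ X , g i ×ᵥ g j ⟩ - ⟨ Y , g i ×ᵥ e j ⟩)
        + ⟨ Z , e i ×ᵥ g j ⟩) - ⟨ T , e i ×ᵥ e j ⟩ ≡ 0#

{-# OPTIONS --safe #-}
-- For an edge ij, with c = g_ij ≠ 0 and S = ⟨X, g(i)×g(j)⟩, the equations of Λ(G,G)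
-- at (i,j) and at (j,i) read  S + Z(i) c = Y(j) c  and  S + Z(j) c = Y(i) c:
-- the T-term vanishes since i ≠ j, and the X-terms agree since G is symmetric.
-- Adding Z(i) c, resp. Z(j) c, gives (Y(i) + Z(i)) c = S + Z(i) c + Z(j) c = (Y(j) + Z(j)) c,
-- so Y + Z takes the same value at both ends of every edge, hence on all of the connected G.
module Submission where

open import Defs
open import Data.Nat using (ℕ; suc; _^_)
open import Data.Nat.Primality using (Prime)
open import Data.Fin using (Fin)
open import Data.Product using (∃)
open import Relation.Binary.PropositionalEquality using (_≡_; _≢_)

open import Level using (0ℓ)
open import Data.Fin using (zero; suc; _≟_)
open import Data.Fin.Properties using (suc-injective)
open import Data.Product using (_,_; _×_)
open import Relation.Binary.Core using (Rel)
open import Relation.Binary.Construct.Closure.ReflexiveTransitive using (Star; fold)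
open import Relation.Binary.PropositionalEquality
  using (_≗_; refl; sym; trans; cong; cong₂; ≢-sym; module ≡-Reasoning)
open import Relation.Nullary using (yes; no; contradiction)
open import Algebra.Structures using (IsCommutativeRing)
open import Algebra.Bundles using (CommutativeRing)

constant-along-Star : ∀ {a b r} {A : Set a} {B : Set b} {R : Rel A r} (f : A → B) →
  (∀ {i j} → R i j → f i ≡ f j) → ∀ {i j} → Star R i j → f i ≡ f j
constant-along-Star f step = fold (λ i j → f i ≡ f j) (λ r eq → trans (step r) eq) refl

module _ (F : FiniteField) where
  open FiniteField F
  open IsCommutativeRing isCommutativeRing
    using (+-identityˡ; +-identityʳ; *-identityʳ; zeroʳ; *-comm; *-assoc; distribʳ)
  open ≡-Reasoning

  private
    commutativeRing : CommutativeRing 0ℓ 0ℓ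
    commutativeRing = record { isCommutativeRing = isCommutativeRing }
    open CommutativeRing commutativeRing using (+-group; +-commutativeSemigroup)
    open import Algebra.Properties.Group +-group using (ε⁻¹≈ε; x∙y⁻¹≈ε⇒x≈y)
    open import Algebra.Properties.CommutativeSemigroup +-commutativeSemigroup using (xy∙z≈xz∙y)

    ⟪_,_⟫ : ∀ {n} → Vector F n → Vector F n → Carrier
    ⟪_,_⟫ = ⟨_,_⟩ F

    infixl 7 _⊙_
    _⊙_ : ∀ {n} → Vector F n → Vector F n → Vector F n
    _⊙_ = _×ᵥ_ F

  x-0#≡x : ∀ x → x - 0# ≡ x
  x-0#≡x x = trans (cong (x +_) ε⁻¹≈ε) (+-identityʳ x)

  *-cancelʳ-≢0 : ∀ {x y c} → c ≢ 0# → x * c ≡ y * c → x ≡ y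
  *-cancelʳ-≢0 {x} {y} {c} c≢0 xc≡yc with inverse c c≢0
  ... | d , cd≡1 = begin
    x               ≡⟨ sym (*-identityʳ x) ⟩
    x * 1#          ≡⟨ cong (x *_) (sym cd≡1) ⟩
    x * (c * d)     ≡⟨ sym (*-assoc x c d) ⟩
    x * c * d       ≡⟨ cong (_* d) xc≡yc ⟩
    y * c * d       ≡⟨ *-assoc y c d ⟩
    y * (c * d)     ≡⟨ cong (y *_) cd≡1 ⟩
    y * 1#          ≡⟨ *-identityʳ y ⟩
    y               ∎

  Σ-cong : ∀ {n} {u v : Vector F n} → u ≗ v → Σ F u ≡ Σ F v
  Σ-cong {ℕ.zero} u≗v = refl
  Σ-cong {suc n}  u≗v = cong₂ _+_ (u≗v zero) (Σ-cong (λ k → u≗v (suc k)))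

  Σ-zero : ∀ {n} (v : Vector F n) → (∀ k → v k ≡ 0#) → Σ F v ≡ 0#
  Σ-zero {ℕ.zero} v v≗0 = refl
  Σ-zero {suc n}  v v≗0 = begin
    v zero + Σ F (λ k → v (suc k)) ≡⟨ cong₂ _+_ (v≗0 zero) (Σ-zero _ (λ k → v≗0 (suc k))) ⟩
    0# + 0#                        ≡⟨ +-identityˡ 0# ⟩
    0#                             ∎

  Σ-single : ∀ {n} (v : Vector F n) j → (∀ k → j ≢ k → v k ≡ 0#) → Σ F v ≡ v j
  Σ-single {suc n} v zero    v≗0 = begin
    v zero + Σ F (λ k → v (suc k)) ≡⟨ cong (v zero +_) (Σ-zero _ (λ k → v≗0 (suc k) λ ())) ⟩
    v zero + 0#                    ≡⟨ +-identityʳ (v zero) ⟩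
    v zero                         ∎
  Σ-single {suc n} v (suc j) v≗0 = begin
    v zero + Σ F (λ k → v (suc k)) ≡⟨ cong₂ _+_ (v≗0 zero λ ()) (Σ-single _ j tail≗0) ⟩
    0# + v (suc j)                 ≡⟨ +-identityˡ (v (suc j)) ⟩
    v (suc j)                      ∎
    where
    tail≗0 : ∀ k → j ≢ k → v (suc k) ≡ 0#
    tail≗0 k j≢k = v≗0 (suc k) (λ sj≡sk → j≢k (suc-injective sj≡sk))

  e-diagonal : ∀ {n} (i : Fin n) → e F i i ≡ 1#
  e-diagonal i with i ≟ i
  ... | yes _   = refl
  ... | no i≢i = contradiction refl i≢i

  e-offDiagonal : ∀ {n} {i k : Fin n} → i ≢ k → e F i k ≡ 0#
  e-offDiagonal {i = i} {k} i≢k with i ≟ k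
  ... | yes i≡k = contradiction i≡k i≢k
  ... | no _    = refl

  ⟪,⊙⟫-comm : ∀ {n} (x u v : Vector F n) → ⟪ x , u ⊙ v ⟫ ≡ ⟪ x , v ⊙ u ⟫
  ⟪,⊙⟫-comm x u v = Σ-cong (λ k → cong (x k *_) (*-comm (u k) (v k)))

  ⟪,⊙e⟫ : ∀ {n} (x u : Vector F n) j → ⟪ x , u ⊙ e F j ⟫ ≡ x j * u j
  ⟪,⊙e⟫ x u j = trans (Σ-single _ j off) (cong (λ t → x j * t) on)
    where
    off : ∀ k → j ≢ k → x k * (u k * e F j k) ≡ 0#
    off k j≢k = trans (cong (λ t → x k * (u k * t)) (e-offDiagonal j≢k))
                      (trans (cong (x k *_) (zeroʳ (u k))) (zeroʳ (x k)))
    on : u j * e F j j ≡ u j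
    on = trans (cong (u j *_) (e-diagonal j)) (*-identityʳ (u j))

  ⟪,e⊙⟫ : ∀ {n} (x u : Vector F n) i → ⟪ x , e F i ⊙ u ⟫ ≡ x i * u i
  ⟪,e⊙⟫ x u i = trans (⟪,⊙⟫-comm x (e F i) u) (⟪,⊙e⟫ x u i)

  module _ {n} (G : LabeledGraph F n) (X Y Z T : Vector F n) (Λ : InΛ F G X Y Z T) where
    open LabeledGraph G

    InΛ-offDiagonal : ∀ {i j} → i ≢ j → ⟪ X , g i ⊙ g j ⟫ + Z i * g i j ≡ Y j * g i j
    InΛ-offDiagonal {i} {j} i≢j = x∙y⁻¹≈ε⇒x≈y _ _ (begin
      (S + Z i * g i j) - Y j * g i j                                         ≡⟨ xy∙z≈xz∙y S _ _ ⟩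
      (S - Y j * g i j) + Z i * g i j                                         ≡⟨ sym (x-0#≡x _) ⟩
      ((S - Y j * g i j) + Z i * g i j) - 0#                                  ≡⟨ cong-terms inner-terms ⟩
      ((S - ⟪ Y , g i ⊙ e F j ⟫) + ⟪ Z , e F i ⊙ g j ⟫) - ⟪ T , e F i ⊙ e F j ⟫ ≡⟨ Λ i j ⟩
      0#                                                                      ∎)
      where
      S = ⟪ X , g i ⊙ g j ⟫
      cong-terms : ∀ {y z t y′ z′ t′} → y ≡ y′ × z ≡ z′ × t ≡ t′ →
                   ((S - y) + z) - t ≡ ((S - y′) + z′) - t′
      cong-terms (refl , refl , refl) = refl
      inner-terms : Y j * g i j ≡ ⟪ Y , g i ⊙ e F j ⟫
                  × Z i * g i j ≡ ⟪ Z , e F i ⊙ g j ⟫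
                  × 0# ≡ ⟪ T , e F i ⊙ e F j ⟫
      inner-terms = sym (⟪,⊙e⟫ Y (g i) j)
                  , trans (cong (Z i *_) (symmetric i j)) (sym (⟪,e⊙⟫ Z (g j) i))
                  , sym (trans (⟪,e⊙⟫ T (e F j) i)
                               (trans (cong (T i *_) (e-offDiagonal (≢-sym i≢j))) (zeroʳ (T i))))

    Y+Z-edge : ∀ {i j} → Edge F G i j → Y i + Z i ≡ Y j + Z j
    Y+Z-edge {i} {j} gij≢0 = *-cancelʳ-≢0 gij≢0 (begin
      (Y i + Z i) * c         ≡⟨ distribʳ c (Y i) (Z i) ⟩
      Y i * c + Z i * c       ≡⟨ cong (_+ Z i * c) (sym Λji) ⟩
      (S + Z j * c) + Z i * c ≡⟨ xy∙z≈xz∙y S _ _ ⟩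
      (S + Z i * c) + Z j * c ≡⟨ cong (_+ Z j * c) (InΛ-offDiagonal i≢j) ⟩
      Y j * c + Z j * c       ≡⟨ sym (distribʳ c (Y j) (Z j)) ⟩
      (Y j + Z j) * c         ∎)
      where
      c = g i j
      S = ⟪ X , g i ⊙ g j ⟫
      i≢j : i ≢ j
      i≢j refl = gij≢0 (zeroDiag i)
      Λji : S + Z j * c ≡ Y i * c
      Λji = begin
        S + Z j * c
          ≡⟨ cong₂ (λ s d → s + Z j * d) (⟪,⊙⟫-comm X (g i) (g j)) (symmetric i j) ⟩
        ⟪ X , g j ⊙ g i ⟫ + Z j * g j i ≡⟨ InΛ-offDiagonal (≢-sym i≢j) ⟩
        Y i * g j i                     ≡⟨ cong (Y i *_) (symmetric j i) ⟩
        Y i * c                         ∎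

    Y+Z-constant : Connected F G → ∀ i j → Y i + Z i ≡ Y j + Z j
    Y+Z-constant connected i j = constant-along-Star (λ k → Y k + Z k) Y+Z-edge (connected i j)

mainTheorem7 : (p k : ℕ) → Prime p → p ≢ 2 → (F : FiniteField) →
    FiniteField.size F ≡ p ^ suc k →
    (n : ℕ) (G : LabeledGraph F n) → Connected F G →
    (X Y Z T : Vector F n) → InΛ F G X Y Z T →
    ∃ λ a → ∀ i → FiniteField._+_ F (Y i) (Z i) ≡ FiniteField._*_ F a (𝟙 F i)
mainTheorem7 _ _ _ _ F _ ℕ.zero  G connected X Y Z T Λ = FiniteField.0# F , λ ()
mainTheorem7 _ _ _ _ F _ (suc n) G connected X Y Z T Λ = Y zero + Z zero , λ i → begin
  Y i + Z i                ≡⟨ Y+Z-constant F G X Y Z T Λ connected i zero ⟩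
  Y zero + Z zero          ≡⟨ sym (*-identityʳ (Y zero + Z zero)) ⟩
  (Y zero + Z zero) * 1#   ∎
  where
  open FiniteField F
  open IsCommutativeRing isCommutativeRing using (*-identityʳ)
  open ≡-Reasoning
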